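{- There exist layered graphs that are not induced subgraphs of any edge layer of any hypercube.
   Context: The hypercube $Q_n$ has vertex set $\{0,1\}^n$ (equivalently subsets of $[n]$), two vertices adjacent iff they differ in exactly one coordinate. Its $k$-th edge layer is the subgraph induced by the vertices with exactly $k$ or $k-1$ ones. A graph is layered if it is a (not necessarily induced) subgraph of some edge layer of some hypercube. -}

module Defs where

open import Data.Nat using (ℕ; zero; suc; _∸_; _≤_)
open import Data.Bool using (Bool; true; false)
open import Data.Fin using (Fin)
open import Data.Vec using (Vec; []; _∷_)
open import Data.Product using (Σ; _×_; ∃)
open import Data.Sum using (_⊎_)
open import Data.Empty using (⊥)
open import Relation.Nullary using (¬_)
open import Relation.Binary.PropositionalEquality using (_≡_)
open import Function.Definitions using (Injective)

record Graph : Set₁ where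
  field
    V     : ℕ
    E     : Fin V → Fin V → Set
    sym   : ∀ {u v} → E u v → E v u
    irrefl : ∀ {v} → ¬ E v v

open Graph public

Cube : ℕ → Set
Cube n = Vec Bool n

weight : ∀ {n} → Cube n → ℕ
weight []          = 0
weight (true ∷ x)  = suc (weight x)
weight (false ∷ x) = weight x

hamming : ∀ {n} → Cube n → Cube n → ℕ
hamming []       []       = 0
hamming (true ∷ x)  (true ∷ y)  = hamming x y
hamming (false ∷ x) (false ∷ y) = hamming x y
hamming (true ∷ x)  (false ∷ y) = suc (hamming x y)
hamming (false ∷ x) (true ∷ y)  = suc (hamming x y)

QAdj : ∀ {n} → Cube n → Cube n → Set
QAdj x y = hamming x y ≡ 1

InLayer : ∀ {n} → ℕ → Cube n → Set
InLayer k x = weight x ≡ k ⊎ weight x ≡ k ∸ 1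

ValidLayer : ℕ → ℕ → Set
ValidLayer n k = 1 ≤ k × k ≤ n

SubgraphOfLayer : Graph → ℕ → ℕ → Set
SubgraphOfLayer G n k =
  Σ (Fin (V G) → Cube n) λ f →
    Injective _≡_ _≡_ f
    × (∀ v → InLayer k (f v))
    × (∀ u v → E G u v → QAdj (f u) (f v))

InducedSubgraphOfLayer : Graph → ℕ → ℕ → Set
InducedSubgraphOfLayer G n k =
  Σ (Fin (V G) → Cube n) λ f →
    Injective _≡_ _≡_ f
    × (∀ v → InLayer k (f v))
    × (∀ u v → E G u v → QAdj (f u) (f v))
    × (∀ u v → QAdj (f u) (f v) → E G u v)

Layered : Graph → Set
Layered G = Σ ℕ λ n → Σ ℕ λ k → ValidLayer n k × SubgraphOfLayer G n k

InducedLayered : Graph → Set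
InducedLayered G = Σ ℕ λ n → Σ ℕ λ k → ValidLayer n k × InducedSubgraphOfLayer G n k

{-# OPTIONS --safe #-}

-- Θ consists of three paths between v0 and v1, of lengths 3, 5 and 5. It sits in the third
-- edge layer of Q₅, though not as an induced subgraph (v7 and v8 are adjacent in Q₅).
--
-- Suppose Θ were induced in a layer, with v0 ↦ u on the upper level (otherwise exchange v0
-- and v1). The short path puts v1 ↦ l on the lower level at distance 3 from u, so exactly two
-- coordinates separate u from l, in the sense that u has a one and l a zero there. On each
-- path the neighbours of u and l are u − i and l + j, at distance 3 ± 1 ± 1, the first sign
-- negative iff i separates and the second iff j separates and differs from i. On the short
-- path they are adjacent, so its coordinates i₀, j₀ are the two separating ones. On a long
-- path they are within distance 3, so it reuses one of them: i = j₀ or j = i₀. Injectivity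
-- forbids both long paths from reusing the same one, so one starts at u − j₀ and the other
-- ends at l + i₀; these two vertices are adjacent, an edge Θ does not have.

module Submission where

open import Defs hiding (sym)
open import Data.Bool using (Bool; true; false; not; if_then_else_)
open import Data.Bool.Properties using (¬-not) renaming (_≟_ to _≟ᵇ_)
open import Data.Empty using (⊥; ⊥-elim)
open import Data.Fin using (Fin; zero; suc; _≟_)
open import Data.Nat using (ℕ; zero; suc; _+_; _≤_; z≤n; s≤s)
open import Data.Nat.Properties using (suc-injective; 1+n≢n; m≢1+n+m)
open import Data.Product using (Σ; ∃; _×_; _,_; proj₁; proj₂)
open import Data.Sum using (_⊎_; inj₁; inj₂; swap)
open import Data.Vec using ([]; _∷_; lookup; updateAt)
open import Data.Vec.Properties using (lookup∘updateAt; lookup∘updateAt′)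
open import Function using (_∘_)
open import Function.Consequences.Propositional using (inverseʳ⇒injective; strictlyInverseʳ⇒inverseʳ)
open import Function.Definitions using (Injective)
open import Relation.Binary.PropositionalEquality
  using (_≡_; _≢_; refl; sym; trans; cong; cong₂; subst; subst₂; ≢-sym; module ≡-Reasoning)
open import Relation.Nullary using (¬_; yes; no; contradiction)

open ≡-Reasoning

toggle : ∀ {n} → Cube n → Fin n → Cube n
toggle x i = updateAt x i not

weight-toggle-true : ∀ {n} (x : Cube n) i → lookup x i ≡ true → weight x ≡ suc (weight (toggle x i))
weight-toggle-true (true ∷ x)  zero    _  = refl
weight-toggle-true (false ∷ x) zero    ()
weight-toggle-true (true ∷ x)  (suc i) xᵢ = cong suc (weight-toggle-true x i xᵢ)
weight-toggle-true (false ∷ x) (suc i) xᵢ = weight-toggle-true x i xᵢ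

weight-toggle-false : ∀ {n} (x : Cube n) i → lookup x i ≡ false → weight (toggle x i) ≡ suc (weight x)
weight-toggle-false (true ∷ x)  zero    ()
weight-toggle-false (false ∷ x) zero    _  = refl
weight-toggle-false (true ∷ x)  (suc i) xᵢ = cong suc (weight-toggle-false x i xᵢ)
weight-toggle-false (false ∷ x) (suc i) xᵢ = weight-toggle-false x i xᵢ

lookup-toggle-true : ∀ {n} (x : Cube n) {i j} → lookup x i ≡ true → lookup (toggle x i) j ≡ true →
                     i ≢ j × lookup x j ≡ true
lookup-toggle-true x {i} {j} xᵢ yⱼ with i ≟ j
... | yes refl = contradiction (trans (cong not (sym xᵢ)) (trans (sym (lookup∘updateAt i x)) yⱼ)) λ ()
... | no i≢j   = i≢j , trans (sym (lookup∘updateAt′ j i (≢-sym i≢j) x)) yⱼ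

hamming-sym : ∀ {n} (x y : Cube n) → hamming x y ≡ hamming y x
hamming-sym []          []          = refl
hamming-sym (true ∷ x)  (true ∷ y)  = hamming-sym x y
hamming-sym (true ∷ x)  (false ∷ y) = cong suc (hamming-sym x y)
hamming-sym (false ∷ x) (true ∷ y)  = cong suc (hamming-sym x y)
hamming-sym (false ∷ x) (false ∷ y) = hamming-sym x y

QAdj-sym : ∀ {n} (x y : Cube n) → QAdj x y → QAdj y x
QAdj-sym x y xy = trans (hamming-sym y x) xy

hamming≡0⇒≡ : ∀ {n} (x y : Cube n) → hamming x y ≡ 0 → x ≡ y
hamming≡0⇒≡ []          []          _ = refl
hamming≡0⇒≡ (true ∷ x)  (true ∷ y)  d = cong (true ∷_) (hamming≡0⇒≡ x y d)
hamming≡0⇒≡ (false ∷ x) (false ∷ y) d = cong (false ∷_) (hamming≡0⇒≡ x y d)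
hamming≡0⇒≡ (true ∷ x)  (false ∷ y) ()
hamming≡0⇒≡ (false ∷ x) (true ∷ y)  ()

QAdj⇒toggle : ∀ {n} (x y : Cube n) → QAdj x y → ∃ λ i → y ≡ toggle x i
QAdj⇒toggle []          []          ()
QAdj⇒toggle (true ∷ x)  (false ∷ y) d = zero , cong (false ∷_) (sym (hamming≡0⇒≡ x y (suc-injective d)))
QAdj⇒toggle (false ∷ x) (true ∷ y)  d = zero , cong (true ∷_) (sym (hamming≡0⇒≡ x y (suc-injective d)))
QAdj⇒toggle (true ∷ x)  (true ∷ y)  d with QAdj⇒toggle x y d
... | i , y≡ = suc i , cong (true ∷_) y≡
QAdj⇒toggle (false ∷ x) (false ∷ y) d with QAdj⇒toggle x y d
... | i , y≡ = suc i , cong (false ∷_) y≡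

hamming-toggle-agree : ∀ {n} (x y : Cube n) i {b} → lookup x i ≡ b → lookup y i ≡ b →
                       hamming (toggle x i) y ≡ suc (hamming x y)
hamming-toggle-agree (true ∷ x)  (true ∷ y)  zero    refl refl = refl
hamming-toggle-agree (false ∷ x) (false ∷ y) zero    refl refl = refl
hamming-toggle-agree (true ∷ x)  (false ∷ y) zero    refl ()
hamming-toggle-agree (false ∷ x) (true ∷ y)  zero    refl ()
hamming-toggle-agree (true ∷ x)  (true ∷ y)  (suc i) xᵢ yᵢ = hamming-toggle-agree x y i xᵢ yᵢ
hamming-toggle-agree (false ∷ x) (false ∷ y) (suc i) xᵢ yᵢ = hamming-toggle-agree x y i xᵢ yᵢ
hamming-toggle-agree (true ∷ x)  (false ∷ y) (suc i) xᵢ yᵢ = cong suc (hamming-toggle-agree x y i xᵢ yᵢ)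
hamming-toggle-agree (false ∷ x) (true ∷ y)  (suc i) xᵢ yᵢ = cong suc (hamming-toggle-agree x y i xᵢ yᵢ)

hamming-toggle-disagree : ∀ {n} (x y : Cube n) i {b} → lookup x i ≡ b → lookup y i ≡ not b →
                          hamming x y ≡ suc (hamming (toggle x i) y)
hamming-toggle-disagree (true ∷ x)  (false ∷ y) zero    refl refl = refl
hamming-toggle-disagree (false ∷ x) (true ∷ y)  zero    refl refl = refl
hamming-toggle-disagree (true ∷ x)  (true ∷ y)  zero    refl ()
hamming-toggle-disagree (false ∷ x) (false ∷ y) zero    refl ()
hamming-toggle-disagree (true ∷ x)  (true ∷ y)  (suc i) xᵢ yᵢ = hamming-toggle-disagree x y i xᵢ yᵢ
hamming-toggle-disagree (false ∷ x) (false ∷ y) (suc i) xᵢ yᵢ = hamming-toggle-disagree x y i xᵢ yᵢ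
hamming-toggle-disagree (true ∷ x)  (false ∷ y) (suc i) xᵢ yᵢ = cong suc (hamming-toggle-disagree x y i xᵢ yᵢ)
hamming-toggle-disagree (false ∷ x) (true ∷ y)  (suc i) xᵢ yᵢ = cong suc (hamming-toggle-disagree x y i xᵢ yᵢ)

hamming-toggleʳ-agree : ∀ {n} (x y : Cube n) j {b} → lookup x j ≡ b → lookup y j ≡ b →
                        hamming x (toggle y j) ≡ suc (hamming x y)
hamming-toggleʳ-agree x y j xⱼ yⱼ = begin
  hamming x (toggle y j)  ≡⟨ hamming-sym x (toggle y j) ⟩
  hamming (toggle y j) x  ≡⟨ hamming-toggle-agree y x j yⱼ xⱼ ⟩
  suc (hamming y x)       ≡⟨ cong suc (hamming-sym y x) ⟩
  suc (hamming x y)       ∎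

hamming-toggleʳ-disagree : ∀ {n} (x y : Cube n) j {b} → lookup x j ≡ not b → lookup y j ≡ b →
                           hamming x y ≡ suc (hamming x (toggle y j))
hamming-toggleʳ-disagree x y j xⱼ yⱼ = begin
  hamming x y                   ≡⟨ hamming-sym x y ⟩
  hamming y x                   ≡⟨ hamming-toggle-disagree y x j yⱼ xⱼ ⟩
  suc (hamming (toggle y j) x)  ≡⟨ cong suc (hamming-sym (toggle y j) x) ⟩
  suc (hamming x (toggle y j))  ∎

hamming-step : ∀ {n} (a b c : Cube n) → QAdj b c →
               hamming a c ≡ suc (hamming a b) ⊎ hamming a b ≡ suc (hamming a c)
hamming-step a b c bc with QAdj⇒toggle b c bc
... | j , refl with lookup a j ≟ᵇ lookup b j
...   | yes aⱼ≡bⱼ = inj₁ (hamming-toggleʳ-agree a b j aⱼ≡bⱼ refl)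
...   | no  aⱼ≢bⱼ = inj₂ (hamming-toggleʳ-disagree a b j (¬-not aⱼ≢bⱼ) refl)

private
  odd-after-two-steps : ∀ {p q} → p ≡ 2 ⊎ 1 ≡ suc p → q ≡ suc p ⊎ p ≡ suc q → q ≡ 1 ⊎ q ≡ 3
  odd-after-two-steps (inj₁ refl) (inj₁ refl) = inj₂ refl
  odd-after-two-steps (inj₁ refl) (inj₂ refl) = inj₁ refl
  odd-after-two-steps (inj₂ refl) (inj₁ refl) = inj₁ refl
  odd-after-two-steps (inj₂ refl) (inj₂ ())

hamming-path3 : ∀ {n} (a b c d : Cube n) → QAdj a b → QAdj b c → QAdj c d →
                hamming a d ≡ 1 ⊎ hamming a d ≡ 3
hamming-path3 a b c d ab bc cd =
  odd-after-two-steps (subst (λ m → hamming a c ≡ suc m ⊎ m ≡ suc (hamming a c)) ab (hamming-step a b c bc))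
                      (hamming-step a c d cd)

adjacent-weights : ∀ {n} (x y : Cube n) → QAdj x y → weight x ≡ suc (weight y) ⊎ weight y ≡ suc (weight x)
adjacent-weights x y xy with QAdj⇒toggle x y xy
... | i , refl with lookup x i in xᵢ
...   | true  = inj₁ (weight-toggle-true x i xᵢ)
...   | false = inj₂ (weight-toggle-false x i xᵢ)

lower-neighbour : ∀ {n k} (x y : Cube n) → QAdj x y → weight x ≡ suc k → weight y ≡ k →
                  ∃ λ i → lookup x i ≡ true × y ≡ toggle x i
lower-neighbour {k = k} x y xy wx wy with QAdj⇒toggle x y xy
... | i , refl with lookup x i in xᵢ
...   | true  = i , xᵢ , refl
...   | false = ⊥-elim (m≢1+n+m k (trans (sym wy) (trans (weight-toggle-false x i xᵢ) (cong suc wx))))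

upper-neighbour : ∀ {n k} (x y : Cube n) → QAdj x y → weight x ≡ k → weight y ≡ suc k →
                  ∃ λ i → lookup x i ≡ false × y ≡ toggle x i
upper-neighbour {k = k} x y xy wx wy with QAdj⇒toggle x y xy
... | i , refl with lookup x i in xᵢ
...   | false = i , xᵢ , refl
...   | true  = ⊥-elim (m≢1+n+m k (trans (sym wx) (trans (weight-toggle-true x i xᵢ) (cong suc wy))))

adjacent-top⇒bottom : ∀ {n k} (x y : Cube n) → InLayer (suc k) y → QAdj x y →
                      weight x ≡ suc k → weight y ≡ k
adjacent-top⇒bottom x y y-layer xy wx with adjacent-weights x y xy | y-layer
... | inj₁ down | _       = suc-injective (trans (sym down) wx)
... | inj₂ up   | inj₁ wy = ⊥-elim (1+n≢n (sym (trans (sym wy) (trans up (cong suc wx)))))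
... | inj₂ up   | inj₂ wy = ⊥-elim (m≢1+n+m _ (trans (sym wy) (trans up (cong suc wx))))

adjacent-bottom⇒top : ∀ {n k} (x y : Cube n) → InLayer (suc k) y → QAdj x y →
                      weight x ≡ k → weight y ≡ suc k
adjacent-bottom⇒top x y y-layer xy wx with adjacent-weights x y xy | y-layer
... | inj₂ up   | _       = trans up (cong suc wx)
... | inj₁ down | inj₁ wy = ⊥-elim (m≢1+n+m _ (trans (sym wx) (trans down (cong suc wy))))
... | inj₁ down | inj₂ wy = ⊥-elim (1+n≢n (sym (trans (sym wx) (trans down (cong suc wy)))))

module Separation {n k} {u l : Cube n} (u-top : weight u ≡ suc k) (l-bottom : weight l ≡ k)
                  (u-l-distance : hamming u l ≡ 3) where

  Separating : Fin n → Set
  Separating c = lookup u c ≡ true × lookup l c ≡ false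

  no-three-separating : ∀ {p q r} → p ≢ q → p ≢ r → q ≢ r →
                        Separating p → Separating q → Separating r → ⊥
  no-three-separating {p} {q} {r} p≢q p≢r q≢r (uₚ , lₚ) (u_q , l_q) (uᵣ , lᵣ) =
    m≢1+n+m k (suc-injective (begin
      suc k          ≡⟨ sym u-top ⟩
      weight u       ≡⟨ weight-drop ⟩
      3 + weight w₃  ≡⟨ cong (λ w → 3 + weight w) w₃≡l ⟩
      3 + weight l   ≡⟨ cong (3 +_) l-bottom ⟩
      3 + k          ∎))
    where
      w₁ w₂ w₃ : Cube n
      w₁ = toggle u p
      w₂ = toggle w₁ q
      w₃ = toggle w₂ r
      w₁q : lookup w₁ q ≡ true
      w₁q = trans (lookup∘updateAt′ q p (≢-sym p≢q) u) u_q
      w₂r : lookup w₂ r ≡ true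
      w₂r = trans (lookup∘updateAt′ r q (≢-sym q≢r) w₁)
                  (trans (lookup∘updateAt′ r p (≢-sym p≢r) u) uᵣ)
      weight-drop : weight u ≡ 3 + weight w₃
      weight-drop = begin
        weight u       ≡⟨ weight-toggle-true u p uₚ ⟩
        1 + weight w₁  ≡⟨ cong suc (weight-toggle-true w₁ q w₁q) ⟩
        2 + weight w₂  ≡⟨ cong (2 +_) (weight-toggle-true w₂ r w₂r) ⟩
        3 + weight w₃  ∎
      hamming-drop : hamming u l ≡ 3 + hamming w₃ l
      hamming-drop = begin
        hamming u l       ≡⟨ hamming-toggle-disagree u l p uₚ lₚ ⟩
        1 + hamming w₁ l  ≡⟨ cong suc (hamming-toggle-disagree w₁ l q w₁q l_q) ⟩
        2 + hamming w₂ l  ≡⟨ cong (2 +_) (hamming-toggle-disagree w₂ l r w₂r lᵣ) ⟩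
        3 + hamming w₃ l  ∎
      w₃≡l : w₃ ≡ l
      w₃≡l = hamming≡0⇒≡ w₃ l
               (suc-injective (suc-injective (suc-injective (trans (sym hamming-drop) u-l-distance))))

  separating-pair : ∀ {p q r} → p ≢ q → Separating p → Separating q → Separating r → r ≡ p ⊎ r ≡ q
  separating-pair {p} {q} {r} p≢q Sₚ S_q Sᵣ with r ≟ p | r ≟ q
  ... | yes r≡p | _       = inj₁ r≡p
  ... | no _    | yes r≡q = inj₂ r≡q
  ... | no r≢p  | no r≢q  = ⊥-elim (no-three-separating p≢q (≢-sym r≢p) (≢-sym r≢q) Sₚ S_q Sᵣ)

  toggle-u-distance : ∀ {i} → lookup u i ≡ true → hamming (toggle u i) l ≡ (if lookup l i then 4 else 2)
  toggle-u-distance {i} uᵢ with lookup l i in lᵢ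
  ... | true  = trans (hamming-toggle-agree u l i uᵢ lᵢ) (cong suc u-l-distance)
  ... | false = suc-injective (trans (sym (hamming-toggle-disagree u l i uᵢ lᵢ)) u-l-distance)

  after-toggles : Bool → Bool → ℕ
  after-toggles false true  = 1
  after-toggles false false = 3
  after-toggles true  true  = 3
  after-toggles true  false = 5

  toggles-distance : ∀ {i j} → lookup u i ≡ true → lookup l j ≡ false →
                     hamming (toggle u i) (toggle l j) ≡ after-toggles (lookup l i) (lookup (toggle u i) j)
  toggles-distance {i} {j} uᵢ lⱼ with lookup l i | toggle-u-distance {i} uᵢ | lookup (toggle u i) j in xⱼ
  ... | false | d | true  = suc-injective (trans (sym (hamming-toggleʳ-disagree (toggle u i) l j xⱼ lⱼ)) d)
  ... | true  | d | true  = suc-injective (trans (sym (hamming-toggleʳ-disagree (toggle u i) l j xⱼ lⱼ)) d)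
  ... | false | d | false = trans (hamming-toggleʳ-agree (toggle u i) l j xⱼ lⱼ) (cong suc d)
  ... | true  | d | false = trans (hamming-toggleʳ-agree (toggle u i) l j xⱼ lⱼ) (cong suc d)

  adjacent-toggles : ∀ {i j} → lookup u i ≡ true → lookup l j ≡ false → QAdj (toggle u i) (toggle l j) →
                     i ≢ j × Separating i × Separating j
  adjacent-toggles {i} {j} uᵢ lⱼ adj = separated (trans (sym (toggles-distance uᵢ lⱼ)) adj)
    where
      separated : after-toggles (lookup l i) (lookup (toggle u i) j) ≡ 1 → i ≢ j × Separating i × Separating j
      separated d with lookup l i | lookup (toggle u i) j in xⱼ
      ... | false | true  = let i≢j , uⱼ = lookup-toggle-true u uᵢ xⱼ in i≢j , (uᵢ , refl) , (uⱼ , lⱼ)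
      ... | false | false = contradiction d λ ()
      ... | true  | true  = contradiction d λ ()
      ... | true  | false = contradiction d λ ()

  near-toggles : ∀ {i j} → lookup u i ≡ true → lookup l j ≡ false →
                 hamming (toggle u i) (toggle l j) ≤ 3 → Separating i ⊎ Separating j
  near-toggles {i} {j} uᵢ lⱼ near = separated (subst (_≤ 3) (toggles-distance uᵢ lⱼ) near)
    where
      separated : after-toggles (lookup l i) (lookup (toggle u i) j) ≤ 3 → Separating i ⊎ Separating j
      separated d with lookup l i | lookup (toggle u i) j in xⱼ
      ... | false | _     = inj₁ (uᵢ , refl)
      ... | true  | true  = inj₂ (proj₂ (lookup-toggle-true u uᵢ xⱼ) , lⱼ)
      ... | true  | false = contradiction d λ { (s≤s (s≤s (s≤s ()))) }

  separating-toggles-adjacent : ∀ {i j} → i ≢ j → Separating i → Separating j →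
                                QAdj (toggle u i) (toggle l j)
  separating-toggles-adjacent {i} {j} i≢j (uᵢ , lᵢ) (uⱼ , lⱼ) =
    trans (toggles-distance uᵢ lⱼ)
          (cong₂ after-toggles lᵢ (trans (lookup∘updateAt′ j i (≢-sym i≢j) u) uⱼ))

-- The trace of an induced copy of Θ in the layer suc k: u and l are the images of v0 and v1, and
-- x s and y s those of the neighbours of v0 and v1 on path s, path zero being the short one.
record LayerTheta (n k : ℕ) : Set where
  field
    u l         : Cube n
    x y         : Fin 3 → Cube n
    u-layer     : InLayer (suc k) u
    l-layer     : InLayer (suc k) l
    x-layer     : ∀ s → InLayer (suc k) (x s)
    y-layer     : ∀ s → InLayer (suc k) (y s)
    u~x         : ∀ s → QAdj u (x s)
    l~y         : ∀ s → QAdj l (y s)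
    x-injective : Injective _≡_ _≡_ x
    y-injective : Injective _≡_ _≡_ y
    u≁l         : ¬ QAdj u l
    x₀~y₀       : QAdj (x zero) (y zero)
    x≈y         : ∀ s → hamming (x s) (y s) ≤ 3
    x~y⇒≡       : ∀ s t → QAdj (x s) (y t) → s ≡ t

mirror : ∀ {n k} → LayerTheta n k → LayerTheta n k
mirror c = record
  { u = l ; l = u ; x = y ; y = x
  ; u-layer = l-layer ; l-layer = u-layer ; x-layer = y-layer ; y-layer = x-layer
  ; u~x = l~y ; l~y = u~x ; x-injective = y-injective ; y-injective = x-injective
  ; u≁l = u≁l ∘ QAdj-sym l u
  ; x₀~y₀ = QAdj-sym (x zero) (y zero) x₀~y₀
  ; x≈y = λ s → subst (_≤ 3) (hamming-sym (x s) (y s)) (x≈y s)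
  ; x~y⇒≡ = λ s t adj → sym (x~y⇒≡ t s (QAdj-sym (y s) (x t) adj))
  }
  where open LayerTheta c

module _ {n k} (c : LayerTheta n k) where
  open LayerTheta c

  y~l : ∀ s → QAdj (y s) l
  y~l s = QAdj-sym l (y s) (l~y s)

  l-bottom : weight u ≡ suc k → weight l ≡ k
  l-bottom u-top =
    adjacent-top⇒bottom (y zero) l l-layer (y~l zero)
      (adjacent-bottom⇒top (x zero) (y zero) (y-layer zero) x₀~y₀
        (adjacent-top⇒bottom u (x zero) (x-layer zero) (u~x zero) u-top))

  l-top : weight u ≡ k → weight l ≡ suc k
  l-top u-bottom =
    adjacent-bottom⇒top (y zero) l l-layer (y~l zero)
      (adjacent-top⇒bottom (x zero) (y zero) (y-layer zero) x₀~y₀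
        (adjacent-bottom⇒top u (x zero) (x-layer zero) (u~x zero) u-bottom))

  u-l-distance : hamming u l ≡ 3
  u-l-distance with hamming-path3 u (x zero) (y zero) l (u~x zero) x₀~y₀ (y~l zero)
  ... | inj₁ adj = contradiction adj u≁l
  ... | inj₂ d   = d

  module _ (u-top : weight u ≡ suc k) where
    open Separation {u = u} {l} u-top (l-bottom u-top) u-l-distance

    lower : ∀ s → ∃ λ i → lookup u i ≡ true × x s ≡ toggle u i
    lower s = lower-neighbour u (x s) (u~x s) u-top
                (adjacent-top⇒bottom u (x s) (x-layer s) (u~x s) u-top)

    upper : ∀ s → ∃ λ j → lookup l j ≡ false × y s ≡ toggle l j
    upper s = upper-neighbour l (y s) (l~y s) (l-bottom u-top)
                (adjacent-bottom⇒top l (y s) (y-layer s) (l~y s) (l-bottom u-top))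

    i j : Fin 3 → Fin n
    i s = proj₁ (lower s)
    j s = proj₁ (upper s)

    uᵢ : ∀ s → lookup u (i s) ≡ true
    uᵢ s = proj₁ (proj₂ (lower s))

    lⱼ : ∀ s → lookup l (j s) ≡ false
    lⱼ s = proj₁ (proj₂ (upper s))

    x≡ : ∀ s → x s ≡ toggle u (i s)
    x≡ s = proj₂ (proj₂ (lower s))

    y≡ : ∀ s → y s ≡ toggle l (j s)
    y≡ s = proj₂ (proj₂ (upper s))

    i-injective : Injective _≡_ _≡_ i
    i-injective {s} {t} e = x-injective (trans (x≡ s) (trans (cong (toggle u) e) (sym (x≡ t))))

    j-injective : Injective _≡_ _≡_ j
    j-injective {s} {t} e = y-injective (trans (y≡ s) (trans (cong (toggle l) e) (sym (y≡ t))))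

    short-path-separating : i zero ≢ j zero × Separating (i zero) × Separating (j zero)
    short-path-separating = adjacent-toggles (uᵢ zero) (lⱼ zero) (subst₂ QAdj (x≡ zero) (y≡ zero) x₀~y₀)

    i₀≢j₀ : i zero ≢ j zero
    i₀≢j₀ = proj₁ short-path-separating

    separating-i₀ : Separating (i zero)
    separating-i₀ = proj₁ (proj₂ short-path-separating)

    separating-j₀ : Separating (j zero)
    separating-j₀ = proj₂ (proj₂ short-path-separating)

    long-path-reuses : ∀ s → s ≢ zero → i s ≡ j zero ⊎ j s ≡ i zero
    long-path-reuses s s≢0
      with near-toggles (uᵢ s) (lⱼ s) (subst₂ (λ p q → hamming p q ≤ 3) (x≡ s) (y≡ s) (x≈y s))
    ... | inj₁ Sᵢ with separating-pair i₀≢j₀ separating-i₀ separating-j₀ Sᵢ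
    ...   | inj₁ iₛ≡i₀ = contradiction (i-injective iₛ≡i₀) s≢0
    ...   | inj₂ iₛ≡j₀ = inj₁ iₛ≡j₀
    long-path-reuses s s≢0 | inj₂ Sⱼ with separating-pair i₀≢j₀ separating-i₀ separating-j₀ Sⱼ
    ...   | inj₁ jₛ≡i₀ = inj₂ jₛ≡i₀
    ...   | inj₂ jₛ≡j₀ = contradiction (j-injective jₛ≡j₀) s≢0

    crossing-adjacent : ∀ {s t} → i s ≡ j zero → j t ≡ i zero → QAdj (x s) (y t)
    crossing-adjacent {s} {t} iₛ≡j₀ jₜ≡i₀ =
      subst₂ QAdj (sym (trans (x≡ s) (cong (toggle u) iₛ≡j₀)))
                  (sym (trans (y≡ t) (cong (toggle l) jₜ≡i₀)))
        (separating-toggles-adjacent (≢-sym i₀≢j₀) separating-j₀ separating-i₀)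

    u-top⇒⊥ : ⊥
    u-top⇒⊥ with long-path-reuses (suc zero) (λ ()) | long-path-reuses (suc (suc zero)) (λ ())
    ... | inj₁ i₁≡j₀ | inj₁ i₂≡j₀ = contradiction (i-injective (trans i₁≡j₀ (sym i₂≡j₀))) λ ()
    ... | inj₂ j₁≡i₀ | inj₂ j₂≡i₀ = contradiction (j-injective (trans j₁≡i₀ (sym j₂≡i₀))) λ ()
    ... | inj₁ i₁≡j₀ | inj₂ j₂≡i₀ = contradiction (x~y⇒≡ _ _ (crossing-adjacent i₁≡j₀ j₂≡i₀)) λ ()
    ... | inj₂ j₁≡i₀ | inj₁ i₂≡j₀ = contradiction (x~y⇒≡ _ _ (crossing-adjacent i₂≡j₀ j₁≡i₀)) λ ()

no-layer-theta : ∀ {n k} → ¬ LayerTheta n k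
no-layer-theta c with LayerTheta.u-layer c
... | inj₁ u-top    = u-top⇒⊥ c u-top
... | inj₂ u-bottom = u-top⇒⊥ (mirror c) (l-top c u-bottom)

pattern v0  = zero
pattern v1  = suc v0
pattern v2  = suc v1
pattern v3  = suc v2
pattern v4  = suc v3
pattern v5  = suc v4
pattern v6  = suc v5
pattern v7  = suc v6
pattern v8  = suc v7
pattern v9  = suc v8
pattern v10 = suc v9
pattern v11 = suc v10

data Θ-Edge : Fin 12 → Fin 12 → Set where
  0-2   : Θ-Edge v0 v2
  2-3   : Θ-Edge v2 v3
  3-1   : Θ-Edge v3 v1
  0-4   : Θ-Edge v0 v4
  4-5   : Θ-Edge v4 v5
  5-6   : Θ-Edge v5 v6
  6-7   : Θ-Edge v6 v7
  7-1   : Θ-Edge v7 v1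
  0-8   : Θ-Edge v0 v8
  8-9   : Θ-Edge v8 v9
  9-10  : Θ-Edge v9 v10
  10-11 : Θ-Edge v10 v11
  11-1  : Θ-Edge v11 v1

Θ : Graph
Θ = record
  { V      = 12
  ; E      = λ v w → Θ-Edge v w ⊎ Θ-Edge w v
  ; sym    = swap
  ; irrefl = λ { (inj₁ ()) ; (inj₂ ()) }
  }

Θ-in-Q₅ : Fin 12 → Cube 5
Θ-in-Q₅ v0  = true  ∷ true  ∷ true  ∷ false ∷ false ∷ []
Θ-in-Q₅ v1  = false ∷ true  ∷ false ∷ true  ∷ false ∷ []
Θ-in-Q₅ v2  = false ∷ true  ∷ true  ∷ false ∷ false ∷ []
Θ-in-Q₅ v3  = false ∷ true  ∷ true  ∷ true  ∷ false ∷ []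
Θ-in-Q₅ v4  = true  ∷ false ∷ true  ∷ false ∷ false ∷ []
Θ-in-Q₅ v5  = true  ∷ false ∷ true  ∷ true  ∷ false ∷ []
Θ-in-Q₅ v6  = true  ∷ false ∷ false ∷ true  ∷ false ∷ []
Θ-in-Q₅ v7  = true  ∷ true  ∷ false ∷ true  ∷ false ∷ []
Θ-in-Q₅ v8  = true  ∷ true  ∷ false ∷ false ∷ false ∷ []
Θ-in-Q₅ v9  = true  ∷ true  ∷ false ∷ false ∷ true  ∷ []
Θ-in-Q₅ v10 = false ∷ true  ∷ false ∷ false ∷ true  ∷ []
Θ-in-Q₅ v11 = false ∷ true  ∷ false ∷ true  ∷ true  ∷ []

Θ-in-Q₅⁻¹ : Cube 5 → Fin 12
Θ-in-Q₅⁻¹ (true  ∷ true  ∷ true  ∷ false ∷ false ∷ []) = v0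
Θ-in-Q₅⁻¹ (false ∷ true  ∷ false ∷ true  ∷ false ∷ []) = v1
Θ-in-Q₅⁻¹ (false ∷ true  ∷ true  ∷ false ∷ false ∷ []) = v2
Θ-in-Q₅⁻¹ (false ∷ true  ∷ true  ∷ true  ∷ false ∷ []) = v3
Θ-in-Q₅⁻¹ (true  ∷ false ∷ true  ∷ false ∷ false ∷ []) = v4
Θ-in-Q₅⁻¹ (true  ∷ false ∷ true  ∷ true  ∷ false ∷ []) = v5
Θ-in-Q₅⁻¹ (true  ∷ false ∷ false ∷ true  ∷ false ∷ []) = v6
Θ-in-Q₅⁻¹ (true  ∷ true  ∷ false ∷ true  ∷ false ∷ []) = v7
Θ-in-Q₅⁻¹ (true  ∷ true  ∷ false ∷ false ∷ false ∷ []) = v8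
Θ-in-Q₅⁻¹ (true  ∷ true  ∷ false ∷ false ∷ true  ∷ []) = v9
Θ-in-Q₅⁻¹ (false ∷ true  ∷ false ∷ false ∷ true  ∷ []) = v10
Θ-in-Q₅⁻¹ (false ∷ true  ∷ false ∷ true  ∷ true  ∷ []) = v11
Θ-in-Q₅⁻¹ _ = v0

Θ-in-Q₅⁻¹-inverse : ∀ v → Θ-in-Q₅⁻¹ (Θ-in-Q₅ v) ≡ v
Θ-in-Q₅⁻¹-inverse v0  = refl
Θ-in-Q₅⁻¹-inverse v1  = refl
Θ-in-Q₅⁻¹-inverse v2  = refl
Θ-in-Q₅⁻¹-inverse v3  = refl
Θ-in-Q₅⁻¹-inverse v4  = refl
Θ-in-Q₅⁻¹-inverse v5  = refl
Θ-in-Q₅⁻¹-inverse v6  = refl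
Θ-in-Q₅⁻¹-inverse v7  = refl
Θ-in-Q₅⁻¹-inverse v8  = refl
Θ-in-Q₅⁻¹-inverse v9  = refl
Θ-in-Q₅⁻¹-inverse v10 = refl
Θ-in-Q₅⁻¹-inverse v11 = refl

Θ-in-Q₅-layer : ∀ v → InLayer 3 (Θ-in-Q₅ v)
Θ-in-Q₅-layer v0  = inj₁ refl
Θ-in-Q₅-layer v1  = inj₂ refl
Θ-in-Q₅-layer v2  = inj₂ refl
Θ-in-Q₅-layer v3  = inj₁ refl
Θ-in-Q₅-layer v4  = inj₂ refl
Θ-in-Q₅-layer v5  = inj₁ refl
Θ-in-Q₅-layer v6  = inj₂ refl
Θ-in-Q₅-layer v7  = inj₁ refl
Θ-in-Q₅-layer v8  = inj₂ refl
Θ-in-Q₅-layer v9  = inj₁ refl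
Θ-in-Q₅-layer v10 = inj₂ refl
Θ-in-Q₅-layer v11 = inj₁ refl

Θ-in-Q₅-edge : ∀ {v w} → Θ-Edge v w → QAdj (Θ-in-Q₅ v) (Θ-in-Q₅ w)
Θ-in-Q₅-edge 0-2   = refl
Θ-in-Q₅-edge 2-3   = refl
Θ-in-Q₅-edge 3-1   = refl
Θ-in-Q₅-edge 0-4   = refl
Θ-in-Q₅-edge 4-5   = refl
Θ-in-Q₅-edge 5-6   = refl
Θ-in-Q₅-edge 6-7   = refl
Θ-in-Q₅-edge 7-1   = refl
Θ-in-Q₅-edge 0-8   = refl
Θ-in-Q₅-edge 8-9   = refl
Θ-in-Q₅-edge 9-10  = refl
Θ-in-Q₅-edge 10-11 = refl
Θ-in-Q₅-edge 11-1  = refl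

Θ-layered : Layered Θ
Θ-layered = 5 , 3 , (s≤s z≤n , s≤s (s≤s (s≤s z≤n))) , Θ-in-Q₅ , injective , Θ-in-Q₅-layer , adjacent
  where
    injective : Injective _≡_ _≡_ Θ-in-Q₅
    injective = inverseʳ⇒injective Θ-in-Q₅
                  (strictlyInverseʳ⇒inverseʳ {f⁻¹ = Θ-in-Q₅⁻¹} Θ-in-Q₅ Θ-in-Q₅⁻¹-inverse)
    adjacent : ∀ v w → E Θ v w → QAdj (Θ-in-Q₅ v) (Θ-in-Q₅ w)
    adjacent v w (inj₁ e) = Θ-in-Q₅-edge e
    adjacent v w (inj₂ e) = QAdj-sym (Θ-in-Q₅ w) (Θ-in-Q₅ v) (Θ-in-Q₅-edge e)

path-start path-end : Fin 3 → Fin 12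
path-start zero             = v2
path-start (suc zero)       = v4
path-start (suc (suc zero)) = v8
path-end zero             = v3
path-end (suc zero)       = v7
path-end (suc (suc zero)) = v11

path-of : Fin 12 → Fin 3
path-of v2  = zero
path-of v3  = zero
path-of v4  = suc zero
path-of v7  = suc zero
path-of v8  = suc (suc zero)
path-of v11 = suc (suc zero)
path-of _   = zero

path-start-injective : Injective _≡_ _≡_ path-start
path-start-injective = inverseʳ⇒injective path-start
  (strictlyInverseʳ⇒inverseʳ {f⁻¹ = path-of} path-start
    λ { zero → refl ; (suc zero) → refl ; (suc (suc zero)) → refl })

path-end-injective : Injective _≡_ _≡_ path-end
path-end-injective = inverseʳ⇒injective path-end
  (strictlyInverseʳ⇒inverseʳ {f⁻¹ = path-of} path-end
    λ { zero → refl ; (suc zero) → refl ; (suc (suc zero)) → refl })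

v0-path-start : ∀ s → E Θ v0 (path-start s)
v0-path-start zero             = inj₁ 0-2
v0-path-start (suc zero)       = inj₁ 0-4
v0-path-start (suc (suc zero)) = inj₁ 0-8

v1-path-end : ∀ s → E Θ v1 (path-end s)
v1-path-end zero             = inj₂ 3-1
v1-path-end (suc zero)       = inj₂ 7-1
v1-path-end (suc (suc zero)) = inj₂ 11-1

path-start-end-edge : ∀ s t → E Θ (path-start s) (path-end t) → s ≡ t
path-start-end-edge zero             zero             _ = refl
path-start-end-edge (suc zero)       (suc zero)       _ = refl
path-start-end-edge (suc (suc zero)) (suc (suc zero)) _ = refl
path-start-end-edge zero             (suc zero)       = λ { (inj₁ ()) ; (inj₂ ()) }
path-start-end-edge zero             (suc (suc zero)) = λ { (inj₁ ()) ; (inj₂ ()) }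
path-start-end-edge (suc zero)       zero             = λ { (inj₁ ()) ; (inj₂ ()) }
path-start-end-edge (suc zero)       (suc (suc zero)) = λ { (inj₁ ()) ; (inj₂ ()) }
path-start-end-edge (suc (suc zero)) zero             = λ { (inj₁ ()) ; (inj₂ ()) }
path-start-end-edge (suc (suc zero)) (suc zero)       = λ { (inj₁ ()) ; (inj₂ ()) }

induced-Θ⇒LayerTheta : ∀ {n k} → InducedSubgraphOfLayer Θ n (suc k) → LayerTheta n k
induced-Θ⇒LayerTheta (f , f-injective , f-layer , f-edge , f-induced) = record
  { u = f v0 ; l = f v1 ; x = f ∘ path-start ; y = f ∘ path-end
  ; u-layer = f-layer v0 ; l-layer = f-layer v1
  ; x-layer = f-layer ∘ path-start ; y-layer = f-layer ∘ path-end
  ; u~x = λ s → f-edge _ _ (v0-path-start s)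
  ; l~y = λ s → f-edge _ _ (v1-path-end s)
  ; x-injective = path-start-injective ∘ f-injective
  ; y-injective = path-end-injective ∘ f-injective
  ; u≁l = v0≁v1 ∘ f-induced v0 v1
  ; x₀~y₀ = f-edge v2 v3 (inj₁ 2-3)
  ; x≈y = within-3
  ; x~y⇒≡ = λ s t adj → path-start-end-edge s t (f-induced _ _ adj)
  }
  where
    v0≁v1 : ¬ E Θ v0 v1
    v0≁v1 (inj₁ ())
    v0≁v1 (inj₂ ())
    odd≤3 : ∀ {m} → m ≡ 1 ⊎ m ≡ 3 → m ≤ 3
    odd≤3 (inj₁ refl) = s≤s z≤n
    odd≤3 (inj₂ refl) = s≤s (s≤s (s≤s z≤n))
    along : ∀ {a b c d} → Θ-Edge a b → Θ-Edge b c → Θ-Edge c d → hamming (f a) (f d) ≤ 3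
    along ab bc cd =
      odd≤3 (hamming-path3 (f _) (f _) (f _) (f _)
               (f-edge _ _ (inj₁ ab)) (f-edge _ _ (inj₁ bc)) (f-edge _ _ (inj₁ cd)))
    within-3 : ∀ s → hamming (f (path-start s)) (f (path-end s)) ≤ 3
    within-3 zero             = odd≤3 (inj₁ (f-edge v2 v3 (inj₁ 2-3)))
    within-3 (suc zero)       = along 4-5 5-6 6-7
    within-3 (suc (suc zero)) = along 8-9 9-10 10-11

lemmaA3 : Σ Graph λ G → Layered G × ¬ InducedLayered G
lemmaA3 = Θ , Θ-layered , Θ-not-induced
  where
    Θ-not-induced : ¬ InducedLayered Θ
    Θ-not-induced (_ , zero  , (() , _) , _)
    Θ-not-induced (_ , suc k , _ , embedding) = no-layer-theta (induced-Θ⇒LayerTheta embedding)
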